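{- Let $\pi^{:}$ be a decorated permutation on $[n]$ with Grassmann necklace $(I_1,\dots,I_n)$ and Grassmann intervals $S^{\pi}_1,\dots,S^{\pi}_n$. Then for all $i,j\in[n]$, $j\in S^{\pi}_i$ if and only if $i\in I_j$ (i.e., the $j$-th column of the $n\times n$ Grassmann matrix $M^{\pi}$, whose $(i,j)$ entry is $1$ if $j\in S^{\pi}_i$ and $0$ otherwise, is the indicator vector of $I_j$). Consequently, for every $j\in[n]$ the number of $i$ with $j\in S^{\pi}_i$ equals $|I_1|$, the rank of the associated positroid.
   Context: For $i\in[n]$ the cyclic order $<_i$ is $i<_i i+1<_i\cdots<_i n<_i 1<_i\cdots<_i i-1$. A decorated permutation on $[n]$ is a pair $(\pi,\operatorname{col})$, $\pi$ a permutation of $[n]$, $\operatorname{col}:[n]\to\{0,1,-1\}$ with $\operatorname{col}(i)=0$ iff $\pi(i)\ne i$. Its Grassmann necklace is $I_i=\{j: j<_i\pi^{ -1}(j)\text{ or }\operatorname{col}(j)=-1\}$ (all of the same size, the rank of the associated positroid). For $a,b\in[n]$ the cyclic interval $(a,b]$ is $\{a+1,a+2,\dots,b\}$ (indices mod $n$), with $(a,a]=\emptyset$. The Grassmann interval is $S^{\pi}_i=(\pi^{ -1}(i),i]$, except $S^{\pi}_i=[n]$ when $\pi(i)=i$ and $\operatorname{col}(i)=-1$. -}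

module Defs where

open import Data.Nat using (ℕ; zero; suc; _∸_; _+_; _≤ᵇ_; _<ᵇ_)
open import Data.Fin using (Fin; toℕ; _≟_)
import Data.Fin as F
open import Data.Fin.Permutation using (Permutation′; _⟨$⟩ʳ_; _⟨$⟩ˡ_)
open import Data.Fin.Subset using (Subset; ∣_∣)
open import Data.Vec using (tabulate)
import Data.Vec
open import Data.Bool using (Bool; true; false; _∧_; _∨_; not; if_then_else_)
open import Data.Product using (_×_)
open import Relation.Binary.PropositionalEquality using (_≡_; _≢_)
open import Relation.Nullary.Decidable using (⌊_⌋)

-- Convention: [n] = {1,…,n} is represented by Fin n = {0,…,n-1}
-- (element k of [n] is represented by k-1); the cyclic structure is unchanged.

data Colour : Set where
  c0 c+1 c-1 : Colour

isMinus : Colour → Bool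
isMinus c-1 = true
isMinus _   = false

record DecoratedPerm (n : ℕ) : Set where
  field
    perm : Permutation′ n
    col  : Fin n → Colour
    col-zero→moved : ∀ i → col i ≡ c0 → perm ⟨$⟩ʳ i ≢ i
    moved→col-zero : ∀ i → perm ⟨$⟩ʳ i ≢ i → col i ≡ c0

-- offset i j = number of steps from i to j in the cyclic order <_i
-- (i has offset 0, i+1 offset 1, …, i-1 offset n-1).
offset : ∀ {n} → Fin n → Fin n → ℕ
offset {n} i j =
  if toℕ i ≤ᵇ toℕ j then toℕ j ∸ toℕ i else (n ∸ toℕ i) + toℕ j

cycLt : ∀ {n} → Fin n → Fin n → Fin n → Bool
cycLt i j k = offset i j <ᵇ offset i k

-- membership in the cyclic interval (a,b] = {a+1,…,b}, with (a,a] = ∅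
inInterval : ∀ {n} → Fin n → Fin n → Fin n → Bool
inInterval a b j = (0 <ᵇ offset a j) ∧ (offset a j ≤ᵇ offset a b)

module _ {n : ℕ} (d : DecoratedPerm n) where
  open DecoratedPerm d

  πinv : Fin n → Fin n
  πinv j = perm ⟨$⟩ˡ j

  necklace : Fin n → Subset n
  necklace i = tabulate (λ j → cycLt i j (πinv j) ∨ isMinus (col j))

  grassInterval : Fin n → Subset n
  grassInterval i = tabulate (λ j →
    if ⌊ perm ⟨$⟩ʳ i ≟ i ⌋ ∧ isMinus (col i)
    then true
    else inInterval (πinv i) i j)

  grassMatrix : Fin n → Fin n → Bool
  grassMatrix i j = Data.Vec.lookup (grassInterval i) j

  column : Fin n → Subset n
  column j = tabulate (λ i → grassMatrix i j)

-- The first element of [n] (i.e. the index 1), available once [n] is inhabited.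
firstOf : ∀ {n} → Fin n → Fin n
firstOf {suc n} _ = F.zero

module Submission where

-- Let offset c x be the position of x in the cyclic order <_c.  A short case analysis gives the
-- cocycle rule offset a b + offset b c = offset a c + n·[c <_a b]; from it, c ∈ (a, b] holds
-- exactly when b <_c a.  Hence the (i, j) entry of the Grassmann matrix is literally the
-- condition "i ∈ I_j", and column j is I_j.
--
-- For the cardinality, fix j: every k lies in exactly one of I_j, the set of k with
-- π⁻¹(k) <_j k (exceedances), or the fixed points coloured +1.  Summing the cocycle rule for
-- j, k, π⁻¹(k) over k, and using that π⁻¹ permutes [n], shows that n times the number of
-- exceedances is Σ_k offset k (π⁻¹ k), which does not depend on j.  So neither does |I_j|.

open import Defs
open import Data.Bool using (Bool; true; false; _∧_; _∨_; not; if_then_else_)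
open import Data.Bool.Properties using (∨-identityʳ; ∨-zeroʳ)
open import Data.Fin using (Fin; toℕ; _≟_; zero; suc)
open import Data.Fin.Permutation using (Permutation′; _⟨$⟩ʳ_; _⟨$⟩ˡ_; inverseˡ; inverseʳ; flip)
open import Data.Fin.Properties using (toℕ<n; toℕ-injective; nonZeroIndex)
open import Data.Fin.Subset using (Subset; _∈_; ∣_∣)
open import Data.Nat using (ℕ; zero; suc; _+_; _*_; _∸_; _≤_; _<_; _≤?_; _<?_)
open import Data.Nat.Properties
  using ( +-*-semiring; +-assoc; +-comm; +-identityʳ; +-cancelˡ-≡; +-cancelʳ-≡; *-cancelʳ-≡
        ; +-cancelˡ-<; +-cancelʳ-<; +-cancelˡ-≤; +-monoˡ-<; +-monoʳ-<; +-monoˡ-≤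
        ; m+[n∸m]≡n; m≤m+n; m≤n+m; m+n≡0⇒m≡0; m+n≡0⇒n≡0; m<n⇒0<n; n≢0⇒n>0
        ; ≤-trans; <-trans; ≤-<-trans; <-irrefl; <-cmp; ≰⇒>; <⇒≤; <⇒≢; >⇒≢; <⇒≱; ≤⇒≯; <⇒≯ )
open import Algebra.Properties.Semiring.Sum +-*-semiring
  using (sum; sum-cong-≗; ∑-distrib-+; sum-permute; *-distribʳ-sum)
open import Data.Nat.Tactic.RingSolver using (solve-∀)
open import Data.Product using (_×_; _,_)
open import Data.Sum using (_⊎_; inj₁; inj₂)
open import Data.Vec using (tabulate; lookup)
open import Data.Vec.Properties using (lookup∘tabulate; tabulate∘lookup; tabulate-cong; []=⇒lookup; lookup⇒[]=)
open import Function using (_∘_)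
open import Function.Bundles using (_⇔_; mk⇔; Equivalence)
open import Relation.Binary using (tri<; tri≈; tri>)
open import Relation.Binary.PropositionalEquality using (_≡_; _≢_; refl; sym; trans; cong; cong₂; subst; subst₂; module ≡-Reasoning)
open import Relation.Nullary using (contradiction; yes; no)
open import Relation.Nullary.Decidable using (⌊_⌋; dec-true; dec-false; does-⇔; _×-dec_)

private
  variable
    n : ℕ

displacements-add : ∀ a b c x y z s t u →
  a + x ≡ b + s → b + y ≡ c + t → a + z ≡ c + u → x + y + u ≡ z + s + t
displacements-add a b c x y z s t u e₁ e₂ e₃ = +-cancelʳ-≡ (a + b + c) _ _ (begin
  x + y + u + (a + b + c)       ≡⟨ shuffle₁ a b c x y u ⟩
  (a + x) + (b + y) + (c + u)   ≡⟨ cong₂ _+_ (cong₂ _+_ e₁ e₂) (sym e₃) ⟩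
  (b + s) + (c + t) + (a + z)   ≡⟨ shuffle₂ a b c z s t ⟩
  z + s + t + (a + b + c)       ∎)
  where
  open ≡-Reasoning
  shuffle₁ : ∀ a b c x y u → x + y + u + (a + b + c) ≡ (a + x) + (b + y) + (c + u)
  shuffle₁ = solve-∀
  shuffle₂ : ∀ a b c z s t → (b + s) + (c + t) + (a + z) ≡ z + s + t + (a + b + c)
  shuffle₂ = solve-∀

-- The forward case carries "+ 0" so that both cases have the shape required by displacements-add.
data OffsetView {n} (i j : Fin n) : Set where
  forward : toℕ i ≤ toℕ j → toℕ i + offset i j ≡ toℕ j + 0 → OffsetView i j
  wrapped : toℕ j < toℕ i → toℕ i + offset i j ≡ toℕ j + n → OffsetView i j

offset-forward : (i j : Fin n) → toℕ i ≤ toℕ j → offset i j ≡ toℕ j ∸ toℕ i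
offset-forward {n} i j i≤j =
  cong (λ b → if b then toℕ j ∸ toℕ i else (n ∸ toℕ i) + toℕ j) (dec-true (toℕ i ≤? toℕ j) i≤j)

offset-wrapped : (i j : Fin n) → toℕ j < toℕ i → offset i j ≡ (n ∸ toℕ i) + toℕ j
offset-wrapped {n} i j j<i =
  cong (λ b → if b then toℕ j ∸ toℕ i else (n ∸ toℕ i) + toℕ j) (dec-false (toℕ i ≤? toℕ j) (<⇒≱ j<i))

offset-view : (i j : Fin n) → OffsetView i j
offset-view {n} i j with toℕ i ≤? toℕ j
... | yes i≤j = forward i≤j (begin
  toℕ i + offset i j      ≡⟨ cong (toℕ i +_) (offset-forward i j i≤j) ⟩
  toℕ i + (toℕ j ∸ toℕ i) ≡⟨ m+[n∸m]≡n i≤j ⟩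
  toℕ j                   ≡⟨ +-identityʳ (toℕ j) ⟨
  toℕ j + 0               ∎)
  where open ≡-Reasoning
... | no i≰j = wrapped j<i (begin
  toℕ i + offset i j              ≡⟨ cong (toℕ i +_) (offset-wrapped i j j<i) ⟩
  toℕ i + ((n ∸ toℕ i) + toℕ j)   ≡⟨ +-assoc (toℕ i) _ _ ⟨
  toℕ i + (n ∸ toℕ i) + toℕ j     ≡⟨ cong (_+ toℕ j) (m+[n∸m]≡n (<⇒≤ (toℕ<n i))) ⟩
  n + toℕ j                       ≡⟨ +-comm n (toℕ j) ⟩
  toℕ j + n                       ∎)
  where
  open ≡-Reasoning
  j<i = ≰⇒> i≰j

offset<n : (i j : Fin n) → offset i j < n
offset<n {n} i j with offset-view i j
... | forward _ e = ≤-<-trans (m≤n+m (offset i j) (toℕ i)) (subst (_< n) (sym (trans e (+-identityʳ _))) (toℕ<n j))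
... | wrapped j<i e = +-cancelˡ-< (toℕ i) (offset i j) n
  (subst (_< toℕ i + n) (sym e) (+-monoˡ-< n j<i))

offset-self : (i : Fin n) → offset i i ≡ 0
offset-self i with offset-view i i
... | forward _ e = +-cancelˡ-≡ (toℕ i) _ _ e
... | wrapped i<i _ = contradiction i<i (<-irrefl refl)

toℕ+0≢toℕ+n : (j k : Fin n) → toℕ j + 0 ≢ toℕ k + n
toℕ+0≢toℕ+n {n} j k e =
  <⇒≱ (toℕ<n j) (subst (n ≤_) (trans (sym e) (+-identityʳ (toℕ j))) (m≤n+m n (toℕ k)))

offset-injective : (i j k : Fin n) → offset i j ≡ offset i k → j ≡ k
offset-injective {n} i j k x≡y = toℕ-injective (lifts (offset-view i j) (offset-view i k))
  where
  same : ∀ {s t} → toℕ i + offset i j ≡ toℕ j + s → toℕ i + offset i k ≡ toℕ k + t →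
         toℕ j + s ≡ toℕ k + t
  same e₁ e₂ = trans (sym e₁) (trans (cong (toℕ i +_) x≡y) e₂)
  lifts : OffsetView i j → OffsetView i k → toℕ j ≡ toℕ k
  lifts (forward _ e₁) (forward _ e₂) = +-cancelʳ-≡ 0 _ _ (same e₁ e₂)
  lifts (forward _ e₁) (wrapped _ e₂) = contradiction (same e₁ e₂) (toℕ+0≢toℕ+n j k)
  lifts (wrapped _ e₁) (forward _ e₂) = contradiction (sym (same e₁ e₂)) (toℕ+0≢toℕ+n k j)
  lifts (wrapped _ e₁) (wrapped _ e₂) = +-cancelʳ-≡ n _ _ (same e₁ e₂)

offset-cocycle : (i j k : Fin n) →
  offset i j + offset j k ≡ offset i k ⊎ offset i j + offset j k ≡ offset i k + n
offset-cocycle {n} i j k = cases (offset-view i j) (offset-view j k) (offset-view i k)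
  where
  x = offset i j
  y = offset j k
  z = offset i k
  translate : ∀ {s t u} → toℕ i + x ≡ toℕ j + s → toℕ j + y ≡ toℕ k + t → toℕ i + z ≡ toℕ k + u →
              x + y + u ≡ z + s + t
  translate = displacements-add (toℕ i) (toℕ j) (toℕ k) x y z _ _ _
  cases : OffsetView i j → OffsetView j k → OffsetView i k → x + y ≡ z ⊎ x + y ≡ z + n
  cases (forward _ e₁) (forward _ e₂) (forward _ e₃) =
    inj₁ (+-cancelʳ-≡ 0 _ _ (trans (translate e₁ e₂ e₃) (+-identityʳ (z + 0))))
  cases (forward i≤j _) (forward j≤k _) (wrapped k<i _) = contradiction (≤-trans i≤j j≤k) (<⇒≱ k<i)
  cases (forward _ e₁) (wrapped _ e₂) (forward _ e₃) =
    inj₂ (trans (sym (+-identityʳ (x + y))) (trans (translate e₁ e₂ e₃) (cong (_+ n) (+-identityʳ z))))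
  cases (forward _ e₁) (wrapped _ e₂) (wrapped _ e₃) =
    inj₁ (+-cancelʳ-≡ n _ _ (trans (translate e₁ e₂ e₃) (cong (_+ n) (+-identityʳ z))))
  cases (wrapped _ e₁) (forward _ e₂) (forward _ e₃) =
    inj₂ (trans (sym (+-identityʳ (x + y))) (trans (translate e₁ e₂ e₃) (+-identityʳ (z + n))))
  cases (wrapped _ e₁) (forward _ e₂) (wrapped _ e₃) =
    inj₁ (+-cancelʳ-≡ n _ _ (trans (translate e₁ e₂ e₃) (+-identityʳ (z + n))))
  cases (wrapped j<i _) (wrapped k<j _) (forward i≤k _) = contradiction (<-trans k<j j<i) (≤⇒≯ i≤k)
  cases (wrapped _ e₁) (wrapped _ e₂) (wrapped _ e₃) = inj₂ (+-cancelʳ-≡ n _ _ (translate e₁ e₂ e₃))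

offset-round-trip : (i j : Fin n) → offset i j + offset j i ≡ 0 ⊎ offset i j + offset j i ≡ n
offset-round-trip {n} i j with offset-cocycle i j i
... | inj₁ e = inj₁ (trans e (offset-self i))
... | inj₂ e = inj₂ (trans e (cong (_+ n) (offset-self i)))

inInterval⇔cycLt : (a b c : Fin n) → (0 < offset a c × offset a c ≤ offset a b) ⇔ offset c b < offset c a
inInterval⇔cycLt {n} a b c = mk⇔ forth back
  where
  P = offset a c
  Q = offset a b
  R = offset c b
  U = offset c a
  forth : 0 < P × P ≤ Q → R < U
  forth (0<P , P≤Q) with offset-round-trip a c | offset-cocycle a c b
  ... | inj₁ P+U≡0 | _ = contradiction (m+n≡0⇒m≡0 P P+U≡0) (>⇒≢ 0<P)
  ... | inj₂ P+U≡n | inj₁ P+R≡Q = +-cancelˡ-< P R U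
    (subst₂ _<_ (sym P+R≡Q) (sym P+U≡n) (offset<n a b))
  ... | inj₂ _ | inj₂ P+R≡Q+n = contradiction
    (+-cancelˡ-≤ Q n R (subst (_≤ Q + R) P+R≡Q+n (+-monoˡ-≤ R P≤Q))) (<⇒≱ (offset<n c b))
  back : R < U → 0 < P × P ≤ Q
  back R<U with offset-round-trip a c | offset-cocycle a c b
  ... | inj₁ P+U≡0 | _ = contradiction (m+n≡0⇒n≡0 P P+U≡0) (>⇒≢ (m<n⇒0<n R<U))
  ... | inj₂ P+U≡n | inj₁ P+R≡Q = 0<P , subst (P ≤_) P+R≡Q (m≤m+n P R)
    where
    0<P : 0 < P
    0<P = n≢0⇒n>0 (λ P≡0 → <⇒≢ (offset<n c a) (trans (cong (_+ U) (sym P≡0)) P+U≡n))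
  ... | inj₂ P+U≡n | inj₂ P+R≡Q+n = contradiction
    (subst₂ _<_ P+R≡Q+n P+U≡n (+-monoʳ-< P R<U)) (≤⇒≯ (m≤n+m n Q))

inInterval≡cycLt : (a b c : Fin n) → inInterval a b c ≡ cycLt c b a
inInterval≡cycLt a b c =
  does-⇔ (inInterval⇔cycLt a b c) ((0 <? offset a c) ×-dec (offset a c ≤? offset a b)) (offset c b <? offset c a)

indicator : Bool → ℕ
indicator true  = 1
indicator false = 0

offset-cocycle-wrap : (i j k : Fin n) →
  offset i j + offset j k ≡ offset i k + indicator (cycLt i k j) * n
offset-cocycle-wrap {n} i j k with offset-cocycle i j k
... | inj₁ x+y≡z
  rewrite dec-false (offset i k <? offset i j) (≤⇒≯ (subst (offset i j ≤_) x+y≡z (m≤m+n _ _)))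
  = trans x+y≡z (sym (+-identityʳ _))
... | inj₂ x+y≡z+n
  rewrite dec-true (offset i k <? offset i j)
    (+-cancelʳ-< n _ _ (subst (_< offset i j + n) x+y≡z+n (+-monoʳ-< (offset i j) (offset<n j k))))
  = trans x+y≡z+n (cong (offset i k +_) (sym (+-identityʳ n)))

sum-ones : ∀ n → sum {n} (λ _ → 1) ≡ n
sum-ones zero    = refl
sum-ones (suc n) = cong suc (sum-ones n)

∣tabulate∣≡sum : (f : Fin n → Bool) → ∣ tabulate f ∣ ≡ sum (indicator ∘ f)
∣tabulate∣≡sum {zero}  f = refl
∣tabulate∣≡sum {suc n} f with f zero
... | true  = cong suc (∣tabulate∣≡sum (f ∘ suc))
... | false = ∣tabulate∣≡sum (f ∘ suc)

sum-∘-inverse : (π : Permutation′ n) (f : Fin n → ℕ) → sum (f ∘ (π ⟨$⟩ˡ_)) ≡ sum f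
sum-∘-inverse π f = sym (sum-permute f (flip π))

∈⇔lookup≡true : {p : Subset n} {i : Fin n} → i ∈ p ⇔ lookup p i ≡ true
∈⇔lookup≡true {p = p} {i} = mk⇔ []=⇒lookup (lookup⇒[]= i p)

∈-transpose : ∀ {m} (p : Fin m → Subset n) (i : Fin m) (j : Fin n) →
  j ∈ p i ⇔ i ∈ tabulate (λ i′ → lookup (p i′) j)
∈-transpose p i j = mk⇔
  (λ j∈pi → Equivalence.from ∈⇔lookup≡true (trans (lookup∘tabulate _ i) (Equivalence.to ∈⇔lookup≡true j∈pi)))
  (λ i∈col → Equivalence.from ∈⇔lookup≡true (trans (sym (lookup∘tabulate _ i)) (Equivalence.to ∈⇔lookup≡true i∈col)))

cycLt-irrefl : (i j : Fin n) → cycLt i j j ≡ false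
cycLt-irrefl i j = dec-false (offset i j <? offset i j) (<-irrefl refl)

module _ {n : ℕ} (d : DecoratedPerm n) where
  open DecoratedPerm d

  πinv-fixed⇒coloured : ∀ {k} → πinv d k ≡ k → col k ≢ c0
  πinv-fixed⇒coloured {k} fixed col-k =
    col-zero→moved k col-k (trans (cong (perm ⟨$⟩ʳ_) (sym fixed)) (inverseʳ perm))

  πinv-moved⇒uncoloured : ∀ {k} → πinv d k ≢ k → col k ≡ c0
  πinv-moved⇒uncoloured {k} moved =
    moved→col-zero k (λ fixed → moved (trans (cong (perm ⟨$⟩ˡ_) (sym fixed)) (inverseˡ perm)))

  inNecklace exceeds : Fin n → Fin n → Bool
  inNecklace j k = cycLt j k (πinv d k) ∨ isMinus (col k)
  exceeds j k    = cycLt j (πinv d k) k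

  positiveLoop : Fin n → Bool
  positiveLoop k = ⌊ πinv d k ≟ k ⌋ ∧ not (isMinus (col k))

  grassInterval-entry≡necklace-entry : ∀ i j →
    (if ⌊ perm ⟨$⟩ʳ i ≟ i ⌋ ∧ isMinus (col i) then true else inInterval (πinv d i) i j)
      ≡ inNecklace j i
  grassInterval-entry≡necklace-entry i j with perm ⟨$⟩ʳ i ≟ i
  ... | no moved rewrite moved→col-zero i moved = trans (inInterval≡cycLt _ i j) (sym (∨-identityʳ _))
  ... | yes _ with col i
  ...   | c-1 = sym (∨-zeroʳ _)
  ...   | c0  = trans (inInterval≡cycLt _ i j) (sym (∨-identityʳ _))
  ...   | c+1 = trans (inInterval≡cycLt _ i j) (sym (∨-identityʳ _))

  column≡necklace : ∀ j → column d j ≡ necklace d j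
  column≡necklace j = trans
    (tabulate-cong λ i → trans (lookup∘tabulate _ j)
      (trans (grassInterval-entry≡necklace-entry i j) (sym (lookup∘tabulate _ i))))
    (tabulate∘lookup (necklace d j))

  exceedances : Fin n → ℕ
  exceedances j = sum (indicator ∘ exceeds j)

  positiveLoops : ℕ
  positiveLoops = sum (indicator ∘ positiveLoop)

  necklace-exceedance-loop-partition : ∀ j k →
    indicator (inNecklace j k) + indicator (exceeds j k) + indicator (positiveLoop k) ≡ 1
  necklace-exceedance-loop-partition j k with πinv d k ≟ k
  ... | yes fixed rewrite fixed | cycLt-irrefl j k with col k in col-k
  ...   | c0  = contradiction col-k (πinv-fixed⇒coloured fixed)
  ...   | c+1 = refl
  ...   | c-1 = refl
  necklace-exceedance-loop-partition j k | no moved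
    rewrite πinv-moved⇒uncoloured moved with <-cmp (offset j k) (offset j (πinv d k))
  ... | tri< k<q _ _ rewrite dec-true (_ <? _) k<q | dec-false (_ <? _) (<⇒≯ k<q) = refl
  ... | tri≈ _ k≈q _ = contradiction (sym (offset-injective j k (πinv d k) k≈q)) moved
  ... | tri> _ _ q<k rewrite dec-false (_ <? _) (<⇒≯ q<k) | dec-true (_ <? _) q<k = refl

  ∣necklace∣+exceedances+positiveLoops≡n : ∀ j → ∣ necklace d j ∣ + exceedances j + positiveLoops ≡ n
  ∣necklace∣+exceedances+positiveLoops≡n j = begin
    ∣ necklace d j ∣ + exceedances j + positiveLoops
      ≡⟨ cong (λ t → t + exceedances j + positiveLoops) (∣tabulate∣≡sum (inNecklace j)) ⟩
    sum (indicator ∘ inNecklace j) + sum (indicator ∘ exceeds j) + sum (indicator ∘ positiveLoop)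
      ≡⟨ cong (_+ positiveLoops) (∑-distrib-+ (indicator ∘ inNecklace j) (indicator ∘ exceeds j)) ⟨
    sum (λ k → indicator (inNecklace j k) + indicator (exceeds j k)) + positiveLoops
      ≡⟨ ∑-distrib-+ (λ k → indicator (inNecklace j k) + indicator (exceeds j k)) (indicator ∘ positiveLoop) ⟨
    sum (λ k → indicator (inNecklace j k) + indicator (exceeds j k) + indicator (positiveLoop k))
      ≡⟨ sum-cong-≗ (necklace-exceedance-loop-partition j) ⟩
    sum {n} (λ _ → 1)
      ≡⟨ sum-ones n ⟩
    n ∎
    where open ≡-Reasoning

  exceedances*n≡total-offset : ∀ j → exceedances j * n ≡ sum (λ k → offset k (πinv d k))
  exceedances*n≡total-offset j = +-cancelˡ-≡ (sum (offset j)) _ _ (begin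
    sum (offset j) + exceedances j * n
      ≡⟨ cong₂ _+_ (sum-∘-inverse perm (offset j)) (sym (*-distribʳ-sum n (indicator ∘ exceeds j))) ⟨
    sum (offset j ∘ πinv d) + sum (λ k → indicator (exceeds j k) * n)
      ≡⟨ ∑-distrib-+ (offset j ∘ πinv d) (λ k → indicator (exceeds j k) * n) ⟨
    sum (λ k → offset j (πinv d k) + indicator (exceeds j k) * n)
      ≡⟨ sum-cong-≗ (λ k → offset-cocycle-wrap j k (πinv d k)) ⟨
    sum (λ k → offset j k + offset k (πinv d k))
      ≡⟨ ∑-distrib-+ (offset j) (λ k → offset k (πinv d k)) ⟩
    sum (offset j) + sum (λ k → offset k (πinv d k)) ∎)
    where open ≡-Reasoning

  ∣necklace∣-constant : ∀ i j → ∣ necklace d i ∣ ≡ ∣ necklace d j ∣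
  ∣necklace∣-constant i j =
    +-cancelʳ-≡ (exceedances i) _ _ (+-cancelʳ-≡ positiveLoops _ _ (begin
      ∣ necklace d i ∣ + exceedances i + positiveLoops   ≡⟨ ∣necklace∣+exceedances+positiveLoops≡n i ⟩
      n                                                 ≡⟨ ∣necklace∣+exceedances+positiveLoops≡n j ⟨
      ∣ necklace d j ∣ + exceedances j + positiveLoops   ≡⟨ cong (λ e → ∣ necklace d j ∣ + e + positiveLoops) exceedances-j≡i ⟩
      ∣ necklace d j ∣ + exceedances i + positiveLoops   ∎))
    where
    open ≡-Reasoning
    instance _ = nonZeroIndex i
    exceedances-j≡i : exceedances j ≡ exceedances i
    exceedances-j≡i = *-cancelʳ-≡ _ _ n
      (trans (exceedances*n≡total-offset j) (sym (exceedances*n≡total-offset i)))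

lemma3p8 : ∀ (n : ℕ) (d : DecoratedPerm n) →
    (∀ (i j : Fin n) → (j ∈ grassInterval d i) ⇔ (i ∈ necklace d j))
    × (∀ (j : Fin n) → ∣ column d j ∣ ≡ ∣ necklace d (firstOf j) ∣)
lemma3p8 n d = column-is-necklace , column-size-is-rank
  where
  column-is-necklace : ∀ (i j : Fin n) → (j ∈ grassInterval d i) ⇔ (i ∈ necklace d j)
  column-is-necklace i j =
    subst (λ s → (j ∈ grassInterval d i) ⇔ (i ∈ s)) (column≡necklace d j) (∈-transpose (grassInterval d) i j)
  column-size-is-rank : ∀ (j : Fin n) → ∣ column d j ∣ ≡ ∣ necklace d (firstOf j) ∣
  column-size-is-rank j = trans (cong ∣_∣ (column≡necklace d j)) (∣necklace∣-constant d j (firstOf j))
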